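{- For every $n\ge 1$, the number of integer sequences $e=(e_1,\dots,e_n)$ with $0\le e_i<i$ for all $i\in[n]$ such that there are no indices $i<j<k$ with $e_j\ge e_k$ and $e_i<e_k$ equals the Catalan number $C_n=\frac{1}{n+1}\binom{2n}{n}$. -}

module Defs where

open import Data.Nat using (ℕ; zero; suc; _<_; _≤_; _+_; _*_; _/_)
open import Data.Nat.Combinatorics using (_C_)
open import Data.Fin using (Fin; toℕ)
open import Data.Vec using (Vec; lookup)
open import Data.Product using (∃-syntax; _×_)
open import Relation.Nullary using (¬_)

-- An inversion sequence of length n: e = (e_1,…,e_n) with 0 ≤ e_i < i.
-- Stored 0-indexed as a vector v with v[i] = e_{i+1} and the bound
-- toℕ v[i] < suc (toℕ i)  i.e.  e_{i+1} < i+1.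
record InvSeq (n : ℕ) : Set where
  constructor mkInvSeq
  field
    entries : Vec ℕ n
    .bounded : ∀ (i : Fin n) → lookup entries i < suc (toℕ i)
open InvSeq public

ContainsPattern : ∀ {n} → InvSeq n → Set
ContainsPattern {n} e =
  ∃[ i ] ∃[ j ] ∃[ k ]
    (toℕ i < toℕ j) × (toℕ j < toℕ k) ×
    (ev k ≤ ev j) × (ev i < ev k)
  where
  ev : Fin n → ℕ
  ev = lookup (entries e)

-- Inversion sequences avoiding the pattern; the avoidance proof is
-- irrelevant, so elements are determined by their underlying sequence.
record AvoidingInvSeq (n : ℕ) : Set where
  constructor mkAvoiding
  field
    seq : InvSeq n
    .avoids : ¬ ContainsPattern seq
open AvoidingInvSeq public

catalan : ℕ → ℕ
catalan n = ((2 * n) C n) / suc n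

-- The first entry of an inversion sequence is 0, so e avoids the pattern exactly when every
-- positive entry is a strict left-to-right maximum.  Such a sequence is read left to right
-- remembering only its current maximum m and the slack d between m and the bound on the next
-- entry: an entry is either 0, and the slack grows by one, or a new maximum m + 1 + j with
-- j ≤ d, and the slack drops to d − j.  The resulting count tails r d of continuations of
-- length r obeys a ballot recursion, solved by tails r d = C(N, k) − C(N, k + 1) with
-- N = 2r + d + 1 and k = r + d + 1; at d = 0 the absorption identity turns this into
-- C(2n + 2, n + 1) / (n + 2).
module Submission where

open import Defs
open import Data.Nat using (ℕ; zero; suc; _+_; _*_; _∸_; _≤_; _<_; z≤n; s≤s; _≟_; _<?_; _/_)
open import Data.Nat.Properties
open import Data.Nat.Combinatorics using (_C_; nCk+nC[k+1]≡[n+1]C[k+1]; nCk≡nC[n∸k]; nCn≡1; nC1≡n; k>n⇒nCk≡0)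
open import Data.Nat.DivMod using (m*n/n≡m)
open import Data.Nat.Tactic.RingSolver using (solve-∀)
open import Data.Fin using (Fin; zero; suc; toℕ; fromℕ<)
open import Data.Fin.Properties using (+↔⊎; toℕ-fromℕ<; toℕ-injective; toℕ<n)
open import Data.Vec using (Vec; []; _∷_; lookup; tail; sum; tabulate)
open import Data.Product using (Σ; _×_; _,_; proj₁; proj₂)
open import Data.Product.Function.Dependent.Propositional using (Σ-↔)
open import Data.Sum using (_⊎_; inj₁; inj₂)
open import Data.Sum.Function.Propositional using (_⊎-↔_)
open import Data.Unit using (⊤; tt)
open import Data.Empty using (⊥-elim)
open import Function using (_∘_; _$_)
open import Function.Bundles using (_↔_; mk↔ₛ′)
open import Function.Properties.Inverse using (↔-refl)
open import Function.Related.Propositional using (module EquationalReasoning)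
open import Relation.Nullary using (yes; no; ¬_)
open import Relation.Nullary.Decidable using (recompute)
open import Relation.Binary.PropositionalEquality using (_≡_; refl; sym; trans; cong; cong₂; subst; subst₂; module ≡-Reasoning)

Σ-Fin-suc↔⊎ : ∀ {n} {P : Fin (suc n) → Set} → Σ (Fin (suc n)) P ↔ (P zero ⊎ Σ (Fin n) (P ∘ suc))
Σ-Fin-suc↔⊎ {n} {P} = mk↔ₛ′ split merge split∘merge merge∘split
  where
  split : Σ (Fin (suc n)) P → P zero ⊎ Σ (Fin n) (P ∘ suc)
  split (zero  , p) = inj₁ p
  split (suc i , p) = inj₂ (i , p)
  merge : P zero ⊎ Σ (Fin n) (P ∘ suc) → Σ (Fin (suc n)) P
  merge (inj₁ p)       = zero , p
  merge (inj₂ (i , p)) = suc i , p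
  split∘merge : ∀ s → split (merge s) ≡ s
  split∘merge (inj₁ p)       = refl
  split∘merge (inj₂ (i , p)) = refl
  merge∘split : ∀ s → merge (split s) ≡ s
  merge∘split (zero  , p) = refl
  merge∘split (suc i , p) = refl

Fin-sum↔Σ : ∀ {n} (f : Fin n → ℕ) → Fin (sum (tabulate f)) ↔ Σ (Fin n) (Fin ∘ f)
Fin-sum↔Σ {zero}  f = mk↔ₛ′ (λ ()) (λ ()) (λ ()) (λ ())
Fin-sum↔Σ {suc n} f = begin
  Fin (f zero + sum (tabulate (f ∘ suc)))         ↔⟨ +↔⊎ ⟩
  (Fin (f zero) ⊎ Fin (sum (tabulate (f ∘ suc)))) ↔⟨ ↔-refl ⊎-↔ Fin-sum↔Σ (f ∘ suc) ⟩
  (Fin (f zero) ⊎ Σ (Fin n) (Fin ∘ f ∘ suc))      ↔⟨ Σ-Fin-suc↔⊎ ⟨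
  Σ (Fin (suc n)) (Fin ∘ f)                       ∎
  where open EquationalReasoning

-- m is the largest entry so far and ℓ the bound on the next entry.
Admissible : ∀ {r} → ℕ → ℕ → Vec ℕ r → Set
Admissible m ℓ []           = ⊤
Admissible m ℓ (zero  ∷ xs) = Admissible m (suc ℓ) xs
Admissible m ℓ (suc y ∷ xs) = m ≤ y × suc y ≤ ℓ × Admissible (suc y) (suc ℓ) xs

-- Indexed by the slack d, so that the bound on the first entry is m + 1 + d.
record Tail (m d r : ℕ) : Set where
  constructor mkTail
  field
    vec         : Vec ℕ r
    .admissible : Admissible m (suc (m + d)) vec

Tail-≡ : ∀ {m d r} {xs ys : Vec ℕ r} → xs ≡ ys →
         .{a : Admissible m (suc (m + d)) xs} .{b : Admissible m (suc (m + d)) ys} →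
         mkTail xs a ≡ mkTail ys b
Tail-≡ refl = refl

tails : ℕ → ℕ → ℕ
tails zero    d = 1
tails (suc r) d = tails r (suc d) + sum (tabulate λ (j : Fin (suc d)) → tails r (d ∸ toℕ j))

m+j+[d∸j]≡m+d : ∀ m {j d} → j ≤ d → m + j + (d ∸ j) ≡ m + d
m+j+[d∸j]≡m+d m {j} {d} j≤d = trans (+-assoc m j (d ∸ j)) (cong (m +_) (m+[n∸m]≡n j≤d))

Tail-unfold : ∀ {m d r} →
  Tail m d (suc r) ↔ (Tail m (suc d) r ⊎ Σ (Fin (suc d)) λ j → Tail (suc (m + toℕ j)) (d ∸ toℕ j) r)
Tail-unfold {m} {d} {r} = mk↔ₛ′ split merge split∘merge merge∘split
  where
  Jump = Σ (Fin (suc d)) λ j → Tail (suc (m + toℕ j)) (d ∸ toℕ j) r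

  jump : ∀ {y} → .(suc y ≤ suc (m + d)) → Fin (suc d)
  jump {y} y<ℓ = fromℕ< (s≤s (subst (y ∸ m ≤_) (m+n∸m≡n m d) (∸-monoˡ-≤ m (≤-pred y<ℓ))))

  m+jump≡y : ∀ {y} → .(m ≤ y) → .(y<ℓ : suc y ≤ suc (m + d)) → m + toℕ (jump y<ℓ) ≡ y
  m+jump≡y {y} m≤y y<ℓ = recompute (_ ≟ y) (trans (cong (m +_) (toℕ-fromℕ< _)) (m+[n∸m]≡n m≤y))

  split : Tail m d (suc r) → Tail m (suc d) r ⊎ Jump
  split (mkTail (zero  ∷ xs) a) =
    inj₁ (mkTail xs (subst (λ ℓ → Admissible m ℓ xs) (cong suc (sym (+-suc m d))) a))
  split (mkTail (suc y ∷ xs) a) =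
    inj₂ (j , mkTail xs (subst₂ (λ z ℓ → Admissible (suc z) ℓ xs) y≡ ℓ≡ (proj₂ (proj₂ a))))
    where
    j = jump (proj₁ (proj₂ a))
    y≡ : y ≡ m + toℕ j
    y≡ = sym (m+jump≡y (proj₁ a) (proj₁ (proj₂ a)))
    ℓ≡ : suc (suc (m + d)) ≡ suc (suc (m + toℕ j + (d ∸ toℕ j)))
    ℓ≡ = cong (2 +_) (sym (m+j+[d∸j]≡m+d m (≤-pred (toℕ<n j))))

  merge : Tail m (suc d) r ⊎ Jump → Tail m d (suc r)
  merge (inj₁ (mkTail xs a))     =
    mkTail (zero ∷ xs) (subst (λ ℓ → Admissible m ℓ xs) (cong suc (+-suc m d)) a)
  merge (inj₂ (j , mkTail xs a)) = mkTail (suc (m + toℕ j) ∷ xs)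
    (m≤m+n m (toℕ j) , s≤s (+-monoʳ-≤ m j≤d) ,
     subst (λ ℓ → Admissible (suc (m + toℕ j)) (suc (suc ℓ)) xs) (m+j+[d∸j]≡m+d m j≤d) a)
    where j≤d = ≤-pred (toℕ<n j)

  split∘merge : ∀ s → split (merge s) ≡ s
  split∘merge (inj₁ (mkTail xs a))     = refl
  split∘merge (inj₂ (j , mkTail xs a)) =
    cong inj₂ (same-jump (toℕ-injective (trans (toℕ-fromℕ< _) (m+n∸m≡n m (toℕ j)))))
    where
    same-jump : ∀ {i} → i ≡ j →
                .{b : Admissible (suc (m + toℕ i)) (suc (suc (m + toℕ i) + (d ∸ toℕ i))) xs} →
                (i , mkTail xs b) ≡ (j , mkTail xs a)
    same-jump refl = refl

  merge∘split : ∀ t → merge (split t) ≡ t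
  merge∘split (mkTail (zero  ∷ xs) a) = refl
  merge∘split (mkTail (suc y ∷ xs) a) =
    Tail-≡ (cong (λ z → suc z ∷ xs) (m+jump≡y (proj₁ a) (proj₁ (proj₂ a))))

Tail↔Fin : ∀ m d r → Tail m d r ↔ Fin (tails r d)
Tail↔Fin m d zero    =
  mk↔ₛ′ (λ _ → zero) (λ _ → mkTail [] tt) (λ { zero → refl }) (λ { (mkTail [] _) → refl })
Tail↔Fin m d (suc r) = begin
  Tail m d (suc r)
    ↔⟨ Tail-unfold ⟩
  (Tail m (suc d) r ⊎ Σ (Fin (suc d)) λ j → Tail (suc (m + toℕ j)) (d ∸ toℕ j) r)
    ↔⟨ Tail↔Fin m (suc d) r ⊎-↔ Σ-↔ ↔-refl (Tail↔Fin _ _ r) ⟩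
  (Fin (tails r (suc d)) ⊎ Σ (Fin (suc d)) λ j → Fin (tails r (d ∸ toℕ j)))
    ↔⟨ ↔-refl ⊎-↔ Fin-sum↔Σ (λ j → tails r (d ∸ toℕ j)) ⟨
  (Fin (tails r (suc d)) ⊎ Fin (sum (tabulate λ (j : Fin (suc d)) → tails r (d ∸ toℕ j))))
    ↔⟨ +↔⊎ ⟨
  Fin (tails (suc r) d)
    ∎
  where open EquationalReasoning

Bounded : ∀ {r} → ℕ → Vec ℕ r → Set
Bounded ℓ xs = ∀ k → lookup xs k ≤ ℓ + toℕ k

PositivesAreRecords : ∀ {r} → ℕ → Vec ℕ r → Set
PositivesAreRecords m xs =
  ∀ k → 0 < lookup xs k → m < lookup xs k × (∀ j → toℕ j < toℕ k → lookup xs j < lookup xs k)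

bounded-tail : ∀ {r ℓ x} {xs : Vec ℕ r} → Bounded ℓ (x ∷ xs) → Bounded (suc ℓ) xs
bounded-tail {ℓ = ℓ} {xs = xs} b k = subst (lookup xs k ≤_) (+-suc ℓ (toℕ k)) (b (suc k))

bounded-cons : ∀ {r ℓ x} {xs : Vec ℕ r} → x ≤ ℓ → Bounded (suc ℓ) xs → Bounded ℓ (x ∷ xs)
bounded-cons {ℓ = ℓ} x≤ℓ b zero    = subst (_ ≤_) (sym (+-identityʳ ℓ)) x≤ℓ
bounded-cons {ℓ = ℓ} {xs = xs} x≤ℓ b (suc k) = subst (lookup xs k ≤_) (sym (+-suc ℓ (toℕ k))) (b k)

records-tail : ∀ {r m x} {xs : Vec ℕ r} → PositivesAreRecords m (x ∷ xs) → PositivesAreRecords m xs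
records-tail p k pos with p (suc k) pos
... | m< , earlier = m< , λ j j<k → earlier (suc j) (s≤s j<k)

records-tail-above : ∀ {r m x} {xs : Vec ℕ r} → PositivesAreRecords m (x ∷ xs) → PositivesAreRecords x xs
records-tail-above p k pos with p (suc k) pos
... | _ , earlier = earlier zero (s≤s z≤n) , λ j j<k → earlier (suc j) (s≤s j<k)

records-cons-zero : ∀ {r m} {xs : Vec ℕ r} → PositivesAreRecords m xs → PositivesAreRecords m (0 ∷ xs)
records-cons-zero p (suc k) pos with p k pos
... | m< , earlier = m< , λ { zero _ → pos ; (suc j) (s≤s j<k) → earlier j j<k }

records-cons-record : ∀ {r m y} {xs : Vec ℕ r} → m ≤ y → PositivesAreRecords (suc y) xs →
                      PositivesAreRecords m (suc y ∷ xs)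
records-cons-record m≤y p zero    _ = s≤s m≤y , λ _ ()
records-cons-record m≤y p (suc k) pos with p k pos
... | y< , earlier = <-trans (s≤s m≤y) y< , λ { zero _ → y< ; (suc j) (s≤s j<k) → earlier j j<k }

admissible⇒bounded : ∀ {r} m ℓ (xs : Vec ℕ r) → Admissible m ℓ xs → Bounded ℓ xs
admissible⇒bounded m ℓ (zero  ∷ xs) a           =
  bounded-cons z≤n (admissible⇒bounded m (suc ℓ) xs a)
admissible⇒bounded m ℓ (suc y ∷ xs) (_ , y<ℓ , a) =
  bounded-cons y<ℓ (admissible⇒bounded (suc y) (suc ℓ) xs a)

admissible⇒records : ∀ {r} m ℓ (xs : Vec ℕ r) → Admissible m ℓ xs → PositivesAreRecords m xs
admissible⇒records m ℓ (zero  ∷ xs) a           =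
  records-cons-zero (admissible⇒records m (suc ℓ) xs a)
admissible⇒records m ℓ (suc y ∷ xs) (m≤y , _ , a) =
  records-cons-record m≤y (admissible⇒records (suc y) (suc ℓ) xs a)

bounded∧records⇒admissible : ∀ {r} m ℓ (xs : Vec ℕ r) →
                             Bounded ℓ xs → PositivesAreRecords m xs → Admissible m ℓ xs
bounded∧records⇒admissible m ℓ []           b p = tt
bounded∧records⇒admissible m ℓ (zero  ∷ xs) b p =
  bounded∧records⇒admissible m (suc ℓ) xs (bounded-tail b) (records-tail p)
bounded∧records⇒admissible m ℓ (suc y ∷ xs) b p =
  ≤-pred (proj₁ (p zero (s≤s z≤n))) , subst (_ ≤_) (+-identityʳ ℓ) (b zero) ,
  bounded∧records⇒admissible (suc y) (suc ℓ) xs (bounded-tail b) (records-tail-above p)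

records⇒avoids : ∀ {n} (e : InvSeq (suc n)) →
                 PositivesAreRecords 0 (tail (entries e)) → ¬ ContainsPattern e
records⇒avoids (mkInvSeq (_ ∷ _) _) p (_ , zero  , _     , () , _ , _)
records⇒avoids (mkInvSeq (_ ∷ _) _) p (_ , suc _ , zero  , _ , () , _)
records⇒avoids (mkInvSeq (_ ∷ _) _) p (_ , suc j , suc k , _ , s≤s j<k , xk≤xj , xi<xk) =
  <⇒≱ (proj₂ (p k (≤-<-trans z≤n xi<xk)) j j<k) xk≤xj

avoids⇒records : ∀ {n} (e : InvSeq (suc n)) →
                 ¬ ContainsPattern e → PositivesAreRecords 0 (tail (entries e))
avoids⇒records (mkInvSeq (x ∷ xs) b) av k pos = pos , earlier
  where
  x≡0 : x ≡ 0
  x≡0 = recompute (x ≟ 0) (n<1⇒n≡0 (b zero))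
  earlier : ∀ j → toℕ j < toℕ k → lookup xs j < lookup xs k
  earlier j j<k with lookup xs j <? lookup xs k
  ... | yes xj<xk = xj<xk
  ... | no  xj≮xk =
    ⊥-elim (av (zero , suc j , suc k , s≤s z≤n , s≤s j<k , ≮⇒≥ xj≮xk , subst (_< lookup xs k) (sym x≡0) pos))

bounded⇒InvSeq-bound : ∀ {n} {xs : Vec ℕ n} → Bounded 1 xs → ∀ i → lookup (0 ∷ xs) i < suc (toℕ i)
bounded⇒InvSeq-bound b zero    = s≤s z≤n
bounded⇒InvSeq-bound b (suc k) = s≤s (b k)

AvoidingInvSeq-≡ : ∀ {n} {v w : Vec ℕ n} → v ≡ w →
  .{b : ∀ i → lookup v i < suc (toℕ i)} .{c : ∀ i → lookup w i < suc (toℕ i)} →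
  .{a : ¬ ContainsPattern (mkInvSeq v b)} .{a′ : ¬ ContainsPattern (mkInvSeq w c)} →
  mkAvoiding (mkInvSeq v b) a ≡ mkAvoiding (mkInvSeq w c) a′
AvoidingInvSeq-≡ refl = refl

AvoidingInvSeq↔Tail : ∀ n → AvoidingInvSeq (suc n) ↔ Tail 0 0 n
AvoidingInvSeq↔Tail n = mk↔ₛ′ to from (λ _ → refl) from∘to
  where
  to : AvoidingInvSeq (suc n) → Tail 0 0 n
  to (mkAvoiding e@(mkInvSeq (_ ∷ xs) b) av) =
    mkTail xs (bounded∧records⇒admissible 0 1 xs (λ k → ≤-pred (b (suc k))) (avoids⇒records e av))
  from : Tail 0 0 n → AvoidingInvSeq (suc n)
  from (mkTail xs a) = mkAvoiding e (records⇒avoids e (admissible⇒records 0 1 xs a))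
    where e = mkInvSeq (0 ∷ xs) (bounded⇒InvSeq-bound (admissible⇒bounded 0 1 xs a))
  from∘to : ∀ e → from (to e) ≡ e
  from∘to (mkAvoiding (mkInvSeq (x ∷ xs) b) av) =
    AvoidingInvSeq-≡ (cong (_∷ xs) (sym (recompute (x ≟ 0) (n<1⇒n≡0 (b zero)))))

-- t = n C k − n C (1 + k), without truncated subtraction.
record Ballot (t n k : ℕ) : Set where
  constructor ballotBy
  field difference : t + n C suc k ≡ n C k
open Ballot

ballot-pascal : ∀ {x y n k} → Ballot x n (suc k) → Ballot y n k → Ballot (x + y) (suc n) (suc k)
ballot-pascal {x} {y} {n} {k} (ballotBy bx) (ballotBy by) = ballotBy $ begin
  (x + y) + suc n C suc (suc k)            ≡⟨ cong ((x + y) +_) (nCk+nC[k+1]≡[n+1]C[k+1] n (suc k)) ⟨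
  (x + y) + (n C suc k + n C suc (suc k))  ≡⟨ interchange x y (n C suc k) (n C suc (suc k)) ⟩
  (x + n C suc (suc k)) + (y + n C suc k)  ≡⟨ cong₂ _+_ bx by ⟩
  n C suc k + n C k                        ≡⟨ +-comm (n C suc k) (n C k) ⟩
  n C k + n C suc k                        ≡⟨ nCk+nC[k+1]≡[n+1]C[k+1] n k ⟩
  suc n C suc k                            ∎
  where
  open ≡-Reasoning
  interchange : ∀ x y a b → (x + y) + (a + b) ≡ (x + b) + (y + a)
  interchange = solve-∀

[1+2r]Cr≡[1+2r]C[1+r] : ∀ r → suc (r + r) C r ≡ suc (r + r) C suc r
[1+2r]Cr≡[1+2r]C[1+r] r = begin
  suc (r + r) C r                   ≡⟨ cong (suc (r + r) C_) (m+n∸m≡n r r) ⟨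
  suc (r + r) C ((r + r) ∸ r)       ≡⟨ nCk≡nC[n∸k] (s≤s (m≤m+n r r)) ⟨
  suc (r + r) C suc r               ∎
  where open ≡-Reasoning

-- At slack 0 the recursion reuses tails r 0 one row further down Pascal's triangle.
ballot-reflect : ∀ {t r} → Ballot t (suc (r + r)) (suc r) → Ballot t (suc (suc (r + r))) (suc r)
ballot-reflect {t} {r} (ballotBy b) = ballotBy $ begin
  t + suc n C suc (suc r)                   ≡⟨ cong (t +_) (nCk+nC[k+1]≡[n+1]C[k+1] n (suc r)) ⟨
  t + (n C suc r + n C suc (suc r))         ≡⟨ cong (t +_) (+-comm (n C suc r) (n C suc (suc r))) ⟩
  t + (n C suc (suc r) + n C suc r)         ≡⟨ +-assoc t (n C suc (suc r)) (n C suc r) ⟨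
  (t + n C suc (suc r)) + n C suc r         ≡⟨ cong (_+ n C suc r) b ⟩
  n C suc r + n C suc r                     ≡⟨ cong (_+ n C suc r) ([1+2r]Cr≡[1+2r]C[1+r] r) ⟨
  n C r + n C suc r                         ≡⟨ nCk+nC[k+1]≡[n+1]C[k+1] n r ⟩
  suc n C suc r                             ∎
  where
  open ≡-Reasoning
  n = suc (r + r)

ballot : ∀ r d → Ballot (tails r d) (suc (d + (r + r))) (suc (d + r))
ballot zero d = ballotBy $ trans (cong suc (k>n⇒nCk≡0 (n<1+n n))) (sym (nCn≡1 n))
  where n = suc (d + 0)
ballot (suc r) zero =
  subst₂ (λ t n → Ballot t n (suc (suc r)))
    (cong (tails r 1 +_) (sym (+-identityʳ (tails r 0))))
    (cong (2 +_) (sym (+-suc r r)))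
    (ballot-pascal (ballot r 1) (ballot-reflect (ballot r 0)))
ballot (suc r) (suc d) =
  ballot-pascal (subst₂ (Ballot _) (n≡ d r) (cong (2 +_) (sym (+-suc d r))) (ballot r (suc (suc d))))
                (ballot (suc r) d)
  where
  n≡ : ∀ d r → 3 + (d + (r + r)) ≡ suc (d + suc (r + suc r))
  n≡ = solve-∀

[k+1]*[n+1]C[k+1]≡[n+1]*nCk : ∀ n k → suc k * (suc n C suc k) ≡ suc n * (n C k)
[k+1]*[n+1]C[k+1]≡[n+1]*nCk zero    zero    = refl
[k+1]*[n+1]C[k+1]≡[n+1]*nCk zero    (suc k) = *-zeroʳ (suc (suc k))
[k+1]*[n+1]C[k+1]≡[n+1]*nCk (suc n) zero    = begin
  1 * (suc (suc n) C 1)  ≡⟨ *-identityˡ (suc (suc n) C 1) ⟩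
  suc (suc n) C 1        ≡⟨ nC1≡n (suc (suc n)) ⟩
  suc (suc n)            ≡⟨ *-identityʳ (suc (suc n)) ⟨
  suc (suc n) * 1        ∎
  where open ≡-Reasoning
[k+1]*[n+1]C[k+1]≡[n+1]*nCk (suc n) (suc k) = begin
  suc (suc k) * (suc (suc n) C suc (suc k))  ≡⟨ cong (suc (suc k) *_) (nCk+nC[k+1]≡[n+1]C[k+1] (suc n) (suc k)) ⟨
  suc (suc k) * (a + b)                      ≡⟨ *-distribˡ-+ (suc (suc k)) a b ⟩
  (a + suc k * a) + suc (suc k) * b          ≡⟨ cong₂ (λ u v → (a + u) + v) ([k+1]*[n+1]C[k+1]≡[n+1]*nCk n k)
                                                                        ([k+1]*[n+1]C[k+1]≡[n+1]*nCk n (suc k)) ⟩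
  (a + suc n * p) + suc n * q                ≡⟨ +-assoc a (suc n * p) (suc n * q) ⟩
  a + (suc n * p + suc n * q)                ≡⟨ cong (a +_) (*-distribˡ-+ (suc n) p q) ⟨
  a + suc n * (p + q)                        ≡⟨ cong (λ z → a + suc n * z) (nCk+nC[k+1]≡[n+1]C[k+1] n k) ⟩
  suc (suc n) * a                            ∎
  where
  open ≡-Reasoning
  a = suc n C suc k
  b = suc n C suc (suc k)
  p = n C k
  q = n C suc k

[2+n]*t≡b+b : ∀ n t b b′ → t + b′ ≡ b → suc (suc n) * (b + b′) ≡ suc (suc (n + n)) * b →
              suc (suc n) * t ≡ b + b
[2+n]*t≡b+b n t b b′ t+b′≡b scaled =
  +-cancelʳ-≡ (suc (suc n) * (b + b′)) (suc (suc n) * t) (b + b) $ begin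
  suc (suc n) * t + suc (suc n) * (b + b′)  ≡⟨ regroup n t b b′ ⟩
  suc (suc n) * ((t + b′) + b)             ≡⟨ cong (λ z → suc (suc n) * (z + b)) t+b′≡b ⟩
  suc (suc n) * (b + b)                    ≡⟨ double n b ⟩
  (b + b) + suc (suc (n + n)) * b          ≡⟨ cong ((b + b) +_) scaled ⟨
  (b + b) + suc (suc n) * (b + b′)          ∎
  where
  open ≡-Reasoning
  regroup : ∀ n t b b′ → suc (suc n) * t + suc (suc n) * (b + b′) ≡ suc (suc n) * ((t + b′) + b)
  regroup = solve-∀
  double : ∀ n b → suc (suc n) * (b + b) ≡ (b + b) + suc (suc (n + n)) * b
  double = solve-∀

catalan≡tails : ∀ n → catalan (suc n) ≡ tails n 0
catalan≡tails n = begin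
  catalan (suc n)                      ≡⟨ cong (_/ suc (suc n)) central ⟩
  (b + b) / suc (suc n)                ≡⟨ cong (_/ suc (suc n)) scaled ⟨
  (suc (suc n) * t) / suc (suc n)      ≡⟨ cong (_/ suc (suc n)) (*-comm (suc (suc n)) t) ⟩
  (t * suc (suc n)) / suc (suc n)      ≡⟨ m*n/n≡m t (suc (suc n)) ⟩
  t                                    ∎
  where
  open ≡-Reasoning
  N = suc (n + n)
  t = tails n 0
  b = N C suc n
  b′ = N C suc (suc n)
  2[1+n]≡1+N : ∀ n → 2 * suc n ≡ suc (suc (n + n))
  2[1+n]≡1+N = solve-∀
  central : (2 * suc n) C suc n ≡ b + b
  central = begin
    (2 * suc n) C suc n  ≡⟨ cong (_C suc n) (2[1+n]≡1+N n) ⟩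
    suc N C suc n        ≡⟨ nCk+nC[k+1]≡[n+1]C[k+1] N n ⟨
    N C n + b            ≡⟨ cong (_+ b) ([1+2r]Cr≡[1+2r]C[1+r] n) ⟩
    b + b                ∎
  absorbed : suc (suc n) * (b + b′) ≡ suc N * b
  absorbed = begin
    suc (suc n) * (b + b′)          ≡⟨ cong (suc (suc n) *_) (nCk+nC[k+1]≡[n+1]C[k+1] N (suc n)) ⟩
    suc (suc n) * (suc N C suc (suc n)) ≡⟨ [k+1]*[n+1]C[k+1]≡[n+1]*nCk N (suc n) ⟩
    suc N * b                       ∎
  scaled : suc (suc n) * t ≡ b + b
  scaled = [2+n]*t≡b+b n t b b′ (difference (ballot n 0)) absorbed

mainTheorem5 : (n : ℕ) → AvoidingInvSeq (suc n) ↔ Fin (catalan (suc n))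
mainTheorem5 n = begin
  AvoidingInvSeq (suc n)  ↔⟨ AvoidingInvSeq↔Tail n ⟩
  Tail 0 0 n              ↔⟨ Tail↔Fin 0 0 n ⟩
  Fin (tails n 0)         ≡⟨ cong Fin (catalan≡tails n) ⟨
  Fin (catalan (suc n))   ∎
  where open EquationalReasoning
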